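{- For every frontal Heyting algebra $\mathfrak H$, $\rho\sigma\mathfrak H=\mathfrak H$; and for every $\mathsf{K4}$-algebra $\mathfrak M$ there is a modal algebra embedding of $\sigma\rho\mathfrak M$ into $\mathfrak M$.
   Context: A frontal Heyting algebra is a Heyting algebra with an operator $\boxtimes$ satisfying $\boxtimes1=1$, $\boxtimes(a\wedge b)=\boxtimes a\wedge\boxtimes b$, $a\leq\boxtimes a$, $\boxtimes a\leq b\vee(b\to a)$. A $\mathsf{K4}$-algebra is a Boolean algebra with $\Box$ satisfying $\Box1=1$, $\Box(a\wedge b)=\Box a\wedge\Box b$, $\Box a\leq\Box\Box a$; $\Box^+a:=a\wedge\Box a$. For a frontal Heyting algebra $\mathfrak H$, $\sigma\mathfrak H$ is its free Boolean extension $B(\mathfrak H)$ (the Boolean algebra in which $\mathfrak H$ embeds as a bounded sublattice generating it; $\mathfrak H$ is identified with its image) expanded with $\Box a:=\boxtimes Ia$, where $Ia:=\bigvee\{b\in H:b\leq a\}$ (which lies in $H$). For a $\mathsf{K4}$-algebra $\mathfrak M$, $\rho\mathfrak M$ is the bounded distributive sublattice $\{a\in M:\Box^+a=a\}$ expanded with $a\to b:=\Box^+(\neg a\vee b)$ and $\boxtimes a:=\Box a$. -}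

module Defs where

open import Level using (Level; _⊔_; suc)
open import Data.Product using (Σ; Σ-syntax; ∃; ∃-syntax; _×_; _,_; proj₁; proj₂)
open import Function.Bundles using (_⇔_)
open import Relation.Binary.Lattice.Bundles using (HeytingAlgebra)
open import Algebra.Lattice.Bundles using (BooleanAlgebra)
import Algebra.Lattice.Properties.BooleanAlgebra as BAProps
import Relation.Binary.Reasoning.Setoid as SetoidR

module _ {c ℓ} (B : BooleanAlgebra c ℓ) where
  open BooleanAlgebra B

  BA≤ : Carrier → Carrier → Set ℓ
  BA≤ x y = x ∧ y ≈ x

record FrontalHeytingAlgebra c ℓ₁ ℓ₂ : Set (suc (c ⊔ ℓ₁ ⊔ ℓ₂)) where
  field
    heytingAlgebra : HeytingAlgebra c ℓ₁ ℓ₂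
  open HeytingAlgebra heytingAlgebra public
  field
    ⊠         : Carrier → Carrier
    ⊠-cong    : ∀ {a b} → a ≈ b → ⊠ a ≈ ⊠ b
    ⊠-⊤       : ⊠ ⊤ ≈ ⊤
    ⊠-∧       : ∀ a b → ⊠ (a ∧ b) ≈ ⊠ a ∧ ⊠ b
    ⊠-infl    : ∀ a → a ≤ ⊠ a
    ⊠-frontal : ∀ a b → ⊠ a ≤ b ∨ (b ⇨ a)

record IsK4 {c ℓ} (B : BooleanAlgebra c ℓ)
            (□ : BooleanAlgebra.Carrier B → BooleanAlgebra.Carrier B) : Set (c ⊔ ℓ) where
  open BooleanAlgebra B
  field
    □-cong : ∀ {a b} → a ≈ b → □ a ≈ □ b
    □-⊤    : □ ⊤ ≈ ⊤
    □-∧    : ∀ a b → □ (a ∧ b) ≈ □ a ∧ □ b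
    □-4    : ∀ a → BA≤ B (□ a) (□ (□ a))

record K4Algebra c ℓ : Set (suc (c ⊔ ℓ)) where
  field
    booleanAlgebra : BooleanAlgebra c ℓ
  open BooleanAlgebra booleanAlgebra public
  field
    □    : Carrier → Carrier
    isK4 : IsK4 booleanAlgebra □
  open IsK4 isK4 public

  □⁺ : Carrier → Carrier
  □⁺ a = a ∧ □ a

  _≤_ : Carrier → Carrier → Set ℓ
  _≤_ = BA≤ booleanAlgebra

record BLatSig a ℓ₁ ℓ₂ : Set (suc (a ⊔ ℓ₁ ⊔ ℓ₂)) where
  field
    Carrier : Set a
    _≈_     : Carrier → Carrier → Set ℓ₁
    _≤_     : Carrier → Carrier → Set ℓ₂
    _∧_     : Carrier → Carrier → Carrier
    _∨_     : Carrier → Carrier → Carrier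
    ⊤       : Carrier
    ⊥       : Carrier

heytingSig : ∀ {c ℓ₁ ℓ₂} → FrontalHeytingAlgebra c ℓ₁ ℓ₂ → BLatSig c ℓ₁ ℓ₂
heytingSig H = record
  { Carrier = Carrier ; _≈_ = _≈_ ; _≤_ = _≤_ ; _∧_ = _∧_ ; _∨_ = _∨_
  ; ⊤ = ⊤ ; ⊥ = ⊥ }
  where open FrontalHeytingAlgebra H

module _ {a ℓ₁ ℓ₂ c ℓ} (L : BLatSig a ℓ₁ ℓ₂) (B : BooleanAlgebra c ℓ)
         (e : BLatSig.Carrier L → BooleanAlgebra.Carrier B) where
  private
    module L = BLatSig L
  open BooleanAlgebra B

  data Generated : Carrier → Set (a ⊔ c ⊔ ℓ) where
    gen-emb : ∀ {x} (u : L.Carrier) → x ≈ e u → Generated x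
    gen-⊤   : ∀ {x} → x ≈ ⊤ → Generated x
    gen-⊥   : ∀ {x} → x ≈ ⊥ → Generated x
    gen-¬   : ∀ {x y} → Generated y → x ≈ ¬ y → Generated x
    gen-∧   : ∀ {x y z} → Generated y → Generated z → x ≈ y ∧ z → Generated x
    gen-∨   : ∀ {x y z} → Generated y → Generated z → x ≈ y ∨ z → Generated x

  record IsFreeBooleanExtension : Set (a ⊔ ℓ₁ ⊔ c ⊔ ℓ) where
    field
      e-cong      : ∀ {u v} → u L.≈ v → e u ≈ e v
      e-injective : ∀ {u v} → e u ≈ e v → u L.≈ v
      e-∧         : ∀ u v → e (u L.∧ v) ≈ e u ∧ e v
      e-∨         : ∀ u v → e (u L.∨ v) ≈ e u ∨ e v
      e-⊤         : e L.⊤ ≈ ⊤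
      e-⊥         : e L.⊥ ≈ ⊥
      generating  : ∀ x → Generated x

  -- I x = ⋁ {u ∈ L : e u ≤ x}, required to exist in L, i.e. to be the
  -- greatest u with e u ≤ x.
  IsInteriorMap : (BooleanAlgebra.Carrier B → BLatSig.Carrier L) → Set (a ⊔ ℓ₂ ⊔ c ⊔ ℓ)
  IsInteriorMap I = ∀ u x → BA≤ B (e u) x ⇔ (u L.≤ I x)

module _ {c ℓ c' ℓ'} (A : BooleanAlgebra c ℓ) (B : BooleanAlgebra c' ℓ') where
  private
    module A = BooleanAlgebra A
    module B = BooleanAlgebra B

  record IsBooleanEmbedding (f : A.Carrier → B.Carrier) : Set (c ⊔ ℓ ⊔ ℓ') where
    field
      f-cong      : ∀ {x y} → x A.≈ y → f x B.≈ f y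
      f-injective : ∀ {x y} → f x B.≈ f y → x A.≈ y
      f-∧         : ∀ x y → f (x A.∧ y) B.≈ f x B.∧ f y
      f-∨         : ∀ x y → f (x A.∨ y) B.≈ f x B.∨ f y
      f-¬         : ∀ x → f (A.¬ x) B.≈ B.¬ (f x)
      f-⊤         : f A.⊤ B.≈ B.⊤
      f-⊥         : f A.⊥ B.≈ B.⊥

σBox : ∀ {c ℓ₁ ℓ₂ c' ℓ'} (H : FrontalHeytingAlgebra c ℓ₁ ℓ₂) (B : BooleanAlgebra c' ℓ')
       (e : FrontalHeytingAlgebra.Carrier H → BooleanAlgebra.Carrier B)
       (I : BooleanAlgebra.Carrier B → FrontalHeytingAlgebra.Carrier H) →
       BooleanAlgebra.Carrier B → BooleanAlgebra.Carrier B
σBox H B e I x = e (FrontalHeytingAlgebra.⊠ H (I x))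

-- "ρ (σ H) = H": σH is a K4-algebra, its □⁺-fixpoints are exactly the
-- image of H, and the operations → and ⊠ of ρσH agree with those of H.
RhoSigmaIsId : ∀ {c ℓ₁ ℓ₂ c' ℓ'} (H : FrontalHeytingAlgebra c ℓ₁ ℓ₂) (B : BooleanAlgebra c' ℓ')
               (e : FrontalHeytingAlgebra.Carrier H → BooleanAlgebra.Carrier B)
               (I : BooleanAlgebra.Carrier B → FrontalHeytingAlgebra.Carrier H) →
               Set (c ⊔ c' ⊔ ℓ')
RhoSigmaIsId H B e I =
    IsK4 B □
  × (∀ x → (x ∧ □ x ≈ x) ⇔ (∃[ u ] (x ≈ e u)))
  × (∀ u v → e (u H.⇨ v) ≈ (¬ e u ∨ e v) ∧ □ (¬ e u ∨ e v))
  × (∀ u → e (H.⊠ u) ≈ □ (e u))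
  where
    module H = FrontalHeytingAlgebra H
    open BooleanAlgebra B
    □ = σBox H B e I

module RhoLemmas {c ℓ} (M : K4Algebra c ℓ) where
  open K4Algebra M
  open BAProps booleanAlgebra using (∧-zeroˡ)
  open import Algebra.Lattice.Properties.Lattice lattice using (∧-idem)
  open SetoidR setoid

  IsFix : Carrier → Set ℓ
  IsFix x = □⁺ x ≈ x

  fix-⊤ : IsFix ⊤
  fix-⊤ = trans (∧-cong refl □-⊤) (∧-idem ⊤)

  fix-⊥ : IsFix ⊥
  fix-⊥ = ∧-zeroˡ (□ ⊥)

  □-mono : ∀ {a b} → a ≤ b → □ a ≤ □ b
  □-mono {a} {b} p = trans (sym (□-∧ a b)) (□-cong p)

  fix-below : ∀ {a c'} → IsFix a → □ a ≤ c' → a ∧ c' ≈ a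
  fix-below {a} {c'} pa q = begin
    a ∧ c'            ≈⟨ ∧-cong (sym pa) refl ⟩
    (a ∧ □ a) ∧ c'    ≈⟨ ∧-assoc a (□ a) c' ⟩
    a ∧ (□ a ∧ c')    ≈⟨ ∧-cong refl q ⟩
    a ∧ □ a           ≈⟨ pa ⟩
    a                 ∎

  fix-∧ : ∀ {a b} → IsFix a → IsFix b → IsFix (a ∧ b)
  fix-∧ {a} {b} pa pb = begin
    (a ∧ b) ∧ □ (a ∧ b)   ≈⟨ ∧-cong refl (□-∧ a b) ⟩
    (a ∧ b) ∧ (□ a ∧ □ b) ≈⟨ ∧-assoc a b (□ a ∧ □ b) ⟩
    a ∧ (b ∧ (□ a ∧ □ b)) ≈⟨ ∧-cong refl (sym (∧-assoc b (□ a) (□ b))) ⟩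
    a ∧ ((b ∧ □ a) ∧ □ b) ≈⟨ ∧-cong refl (∧-cong (∧-comm b (□ a)) refl) ⟩
    a ∧ ((□ a ∧ b) ∧ □ b) ≈⟨ ∧-cong refl (∧-assoc (□ a) b (□ b)) ⟩
    a ∧ (□ a ∧ (b ∧ □ b)) ≈⟨ sym (∧-assoc a (□ a) (b ∧ □ b)) ⟩
    (a ∧ □ a) ∧ (b ∧ □ b) ≈⟨ ∧-cong pa pb ⟩
    a ∧ b                 ∎

  fix-∨ : ∀ {a b} → IsFix a → IsFix b → IsFix (a ∨ b)
  fix-∨ {a} {b} pa pb = begin
    (a ∨ b) ∧ □ (a ∨ b)              ≈⟨ ∧-distribʳ-∨ (□ (a ∨ b)) a b ⟩
    (a ∧ □ (a ∨ b)) ∨ (b ∧ □ (a ∨ b)) ≈⟨ ∨-cong (fix-below pa (□-mono (∧-absorbs-∨ a b)))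
                                               (fix-below pb (□-mono b≤a∨b)) ⟩
    a ∨ b                             ∎
    where
      b≤a∨b : b ∧ (a ∨ b) ≈ b
      b≤a∨b = trans (∧-cong refl (∨-comm a b)) (∧-absorbs-∨ b a)

  fix-□ : ∀ a → IsFix (□ a)
  fix-□ a = □-4 a

ρSig : ∀ {c ℓ} → K4Algebra c ℓ → BLatSig (c ⊔ ℓ) ℓ ℓ
ρSig M = record
  { Carrier = Σ[ x ∈ Carrier ] IsFix x
  ; _≈_ = λ x y → proj₁ x ≈ proj₁ y
  ; _≤_ = λ x y → proj₁ x ≤ proj₁ y
  ; _∧_ = λ x y → (proj₁ x ∧ proj₁ y) , fix-∧ (proj₂ x) (proj₂ y)
  ; _∨_ = λ x y → (proj₁ x ∨ proj₁ y) , fix-∨ (proj₂ x) (proj₂ y)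
  ; ⊤ = ⊤ , fix-⊤
  ; ⊥ = ⊥ , fix-⊥ }
  where
    open K4Algebra M
    open RhoLemmas M

-- the operator □ x := ⊠ (I x) on σ (ρ M), where ⊠ of ρ M is □ of M
σρBox : ∀ {c ℓ c' ℓ'} (M : K4Algebra c ℓ) (B : BooleanAlgebra c' ℓ')
        (e : BLatSig.Carrier (ρSig M) → BooleanAlgebra.Carrier B)
        (I : BooleanAlgebra.Carrier B → BLatSig.Carrier (ρSig M)) →
        BooleanAlgebra.Carrier B → BooleanAlgebra.Carrier B
σρBox M B e I x = e (K4Algebra.□ M (proj₁ (I x)) , RhoLemmas.fix-□ M (proj₁ (I x)))

{-# OPTIONS --safe #-}
-- Every element of the free Boolean extension e : H ↪ B is a finite meet of clauses ¬ e a ∨ e b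
-- (such meets are closed under ∨ and ¬ by distributivity and de Morgan), and e w ≤ ¬ e a ∨ e b
-- iff w ≤ a ⇨ b; so the interior I exists and sends a meet of clauses to the meet of the a ⇨ b.
-- Frontality gives ⊠ (a ⇨ b) ≤ a ∨ (a ⇨ b), whence, resolving on e a,
-- (¬ e a ∨ e b) ∧ □ (¬ e a ∨ e b) ≤ e (a ⇨ b).  This computes the implication of ρσH, and shows
-- that a □⁺-fixpoint of σH, lying below each clause of its normal form and below its box, lies
-- below e of the meet of the corresponding a ⇨ b, hence equals it and belongs to H.
-- For a K4-algebra M, the Boolean subalgebra generated by the □⁺-fixpoints is a free Boolean
-- extension of ρM with interior □⁺, and axiom 4 gives □ ∘ □⁺ = □, so the inclusion preserves □.
module Submission where

open import Defs
open import Level using (_⊔_)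
open import Data.Product using (Σ; Σ-syntax; _×_; ∃-syntax; _,_; proj₁; proj₂)
open import Algebra.Lattice.Bundles using (BooleanAlgebra; RawLattice)
open import Data.List using (List; []; _∷_; _++_; map; cartesianProductWith)
open import Function.Base using (id)
open import Function.Bundles using (_⇔_; mk⇔; Equivalence)
open import Algebra.Bundles using (CommutativeSemiring)
open import Algebra.Lattice.Morphism.Structures using (IsLatticeMonomorphism)
import Algebra.Lattice.Morphism.LatticeMonomorphism as LatticeMonomorphism
import Algebra.Lattice.Properties.BooleanAlgebra as BooleanAlgebraProperties
import Algebra.Properties.CommutativeSemigroup as CommutativeSemigroupProperties
import Relation.Binary.Lattice.Bundles as Order
import Relation.Binary.Lattice.Properties.MeetSemilattice as MeetSemilatticeProperties
import Relation.Binary.Lattice.Properties.JoinSemilattice as JoinSemilatticeProperties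
import Relation.Binary.Lattice.Properties.HeytingAlgebra as HeytingAlgebraProperties
import Relation.Binary.Reasoning.PartialOrder as ≤-Reasoning
import Relation.Binary.Reasoning.Setoid as ≈-Reasoning

module BooleanAlgebraOrder {c ℓ} (B : BooleanAlgebra c ℓ) where
  open BooleanAlgebra B
  open BooleanAlgebraProperties B
    using (∨-∧-orderTheoreticLattice; ∧-identityʳ; ∨-identityˡ; ∨-∧-commutativeSemiring)
  private module Natural = Order.Lattice ∨-∧-orderTheoreticLattice

  -- The library orders a lattice by  x ≈ x ∧ y ; BA≤ is that order with the equation flipped.
  ≤-lattice : Order.Lattice c ℓ ℓ
  ≤-lattice = record
    { _≤_       = BA≤ B
    ; isLattice = record
      { isPartialOrder = record
        { isPreorder = record
          { isEquivalence = isEquivalence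
          ; reflexive     = λ x≈y → sym (Natural.reflexive x≈y)
          ; trans         = λ x≤y y≤z → sym (Natural.trans (sym x≤y) (sym y≤z))
          }
        ; antisym = λ x≤y y≤x → Natural.antisym (sym x≤y) (sym y≤x)
        }
      ; supremum = λ x y →
          sym (Natural.x≤x∨y x y) , sym (Natural.y≤x∨y x y) ,
          λ z x≤z y≤z → sym (Natural.∨-least (sym x≤z) (sym y≤z))
      ; infimum = λ x y →
          sym (Natural.x∧y≤x x y) , sym (Natural.x∧y≤y x y) ,
          λ z z≤x z≤y → sym (Natural.∧-greatest (sym z≤x) (sym z≤y))
      }
    }

  open Order.Lattice ≤-lattice public
    using (_≤_; poset; ≤-respˡ-≈; ≤-respʳ-≈; ∨-least; x∧y≤x; x∧y≤y; ∧-greatest)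
    renaming (refl to ≤-refl; reflexive to ≤-reflexive; trans to ≤-trans; antisym to ≤-antisym)
  open MeetSemilatticeProperties (Order.Lattice.meetSemilattice ≤-lattice) public
    using (∧-monotonic)
  open JoinSemilatticeProperties (Order.Lattice.joinSemilattice ≤-lattice) public
    using (∨-monotonic)

  ≤-⊤ : ∀ x → x ≤ ⊤
  ≤-⊤ = ∧-identityʳ

  shunt : ∀ {y a b} → y ∧ a ≤ b ⇔ y ≤ ¬ a ∨ b
  shunt {y} {a} {b} = mk⇔ to from
    where
    open ≤-Reasoning poset
    to : y ∧ a ≤ b → y ≤ ¬ a ∨ b
    to y∧a≤b = begin
      y                      ≈⟨ ∧-identityʳ y ⟨
      y ∧ ⊤                  ≈⟨ ∧-cong refl (∨-complementʳ a) ⟨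
      y ∧ (a ∨ ¬ a)          ≈⟨ ∧-distribˡ-∨ y a (¬ a) ⟩
      (y ∧ a) ∨ (y ∧ ¬ a)    ≤⟨ ∨-monotonic y∧a≤b (x∧y≤y y (¬ a)) ⟩
      b ∨ ¬ a                ≈⟨ ∨-comm b (¬ a) ⟩
      ¬ a ∨ b                ∎
    from : y ≤ ¬ a ∨ b → y ∧ a ≤ b
    from y≤¬a∨b = begin
      y ∧ a                  ≤⟨ ∧-monotonic y≤¬a∨b ≤-refl ⟩
      (¬ a ∨ b) ∧ a          ≈⟨ ∧-distribʳ-∨ a (¬ a) b ⟩
      (¬ a ∧ a) ∨ (b ∧ a)    ≈⟨ ∨-cong (∧-complementˡ a) refl ⟩
      ⊥ ∨ (b ∧ a)            ≈⟨ ∨-identityˡ (b ∧ a) ⟩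
      b ∧ a                  ≤⟨ x∧y≤x b a ⟩
      b                      ∎

  resolution : ∀ p q r → (¬ p ∨ q) ∧ (p ∨ r) ≤ q ∨ r
  resolution p q r = begin
    (¬ p ∨ q) ∧ (p ∨ r)                   ≈⟨ ∧-distribˡ-∨ (¬ p ∨ q) p r ⟩
    ((¬ p ∨ q) ∧ p) ∨ ((¬ p ∨ q) ∧ r)     ≤⟨ ∨-monotonic (Equivalence.from shunt ≤-refl) (x∧y≤y _ r) ⟩
    q ∨ r                                 ∎
    where open ≤-Reasoning poset

  ∨-interchange : ∀ w x y z → (w ∨ x) ∨ (y ∨ z) ≈ (w ∨ y) ∨ (x ∨ z)
  ∨-interchange = CommutativeSemigroupProperties.interchange
    (CommutativeSemiring.+-commutativeSemigroup ∨-∧-commutativeSemiring)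

module Subalgebra {c ℓ p} (B : BooleanAlgebra c ℓ) (P : BooleanAlgebra.Carrier B → Set p)
  (P-⊤ : P (BooleanAlgebra.⊤ B)) (P-⊥ : P (BooleanAlgebra.⊥ B))
  (P-¬ : ∀ {x} → P x → P (BooleanAlgebra.¬_ B x))
  (P-∧ : ∀ {x y} → P x → P y → P (BooleanAlgebra._∧_ B x y))
  (P-∨ : ∀ {x y} → P x → P y → P (BooleanAlgebra._∨_ B x y)) where

  open BooleanAlgebra B

  private
    Elem : Set (c ⊔ p)
    Elem = Σ Carrier P

    raw : RawLattice (c ⊔ p) ℓ
    raw = record
      { Carrier = Elem
      ; _≈_     = λ x y → proj₁ x ≈ proj₁ y
      ; _∧_     = λ x y → proj₁ x ∧ proj₁ y , P-∧ (proj₂ x) (proj₂ y)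
      ; _∨_     = λ x y → proj₁ x ∨ proj₁ y , P-∨ (proj₂ x) (proj₂ y)
      }

    proj₁-isLatticeMonomorphism : IsLatticeMonomorphism raw rawLattice proj₁
    proj₁-isLatticeMonomorphism = record
      { isLatticeHomomorphism = record
        { isRelHomomorphism = record { cong = id }
        ; ∧-homo            = λ _ _ → refl
        ; ∨-homo            = λ _ _ → refl
        }
      ; injective = id
      }

  subalgebra : BooleanAlgebra (c ⊔ p) ℓ
  subalgebra = record
    { Carrier          = Elem
    ; _≈_              = RawLattice._≈_ raw
    ; _∧_              = RawLattice._∧_ raw
    ; _∨_              = RawLattice._∨_ raw
    ; ⊤                = ⊤ , P-⊤
    ; ⊥                = ⊥ , P-⊥
    ; ¬_               = λ x → ¬ proj₁ x , P-¬ (proj₂ x)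
    ; isBooleanAlgebra = record
      { isDistributiveLattice =
          LatticeMonomorphism.isDistributiveLattice proj₁-isLatticeMonomorphism isDistributiveLattice
      ; ∨-complement = (λ x → ∨-complementˡ (proj₁ x)) , (λ x → ∨-complementʳ (proj₁ x))
      ; ∧-complement = (λ x → ∧-complementˡ (proj₁ x)) , (λ x → ∧-complementʳ (proj₁ x))
      ; ¬-cong       = ¬-cong
      }
    }

  proj₁-isBooleanEmbedding : IsBooleanEmbedding subalgebra B proj₁
  proj₁-isBooleanEmbedding = record
    { f-cong = id ; f-injective = id
    ; f-∧ = λ _ _ → refl ; f-∨ = λ _ _ → refl ; f-¬ = λ _ → refl
    ; f-⊤ = refl ; f-⊥ = refl
    }

module ClausalNormalForm {c ℓ a} (B : BooleanAlgebra c ℓ) {Clause : Set a}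
  (⟦_⟧ : Clause → BooleanAlgebra.Carrier B) (_∨ᶜ_ : Clause → Clause → Clause)
  (⟦∨ᶜ⟧ : ∀ p q → BooleanAlgebra._≈_ B ⟦ p ∨ᶜ q ⟧ (BooleanAlgebra._∨_ B ⟦ p ⟧ ⟦ q ⟧)) where

  open BooleanAlgebra B

  open BooleanAlgebraProperties B using (∧-identityˡ; ∨-zeroʳ; ∨-zeroˡ)
  open ≈-Reasoning setoid

  ⋀ : List Clause → Carrier
  ⋀ []       = ⊤
  ⋀ (p ∷ ps) = ⟦ p ⟧ ∧ ⋀ ps

  ⋀-++ : ∀ ps qs → ⋀ (ps ++ qs) ≈ ⋀ ps ∧ ⋀ qs
  ⋀-++ []       qs = sym (∧-identityˡ (⋀ qs))
  ⋀-++ (p ∷ ps) qs = trans (∧-cong refl (⋀-++ ps qs)) (sym (∧-assoc ⟦ p ⟧ (⋀ ps) (⋀ qs)))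

  infixr 6 _∨ᶠ_
  _∨ᶠ_ : List Clause → List Clause → List Clause
  _∨ᶠ_ = cartesianProductWith _∨ᶜ_

  ⋀-map-∨ᶜ : ∀ p qs → ⋀ (map (p ∨ᶜ_) qs) ≈ ⟦ p ⟧ ∨ ⋀ qs
  ⋀-map-∨ᶜ p []       = sym (∨-zeroʳ ⟦ p ⟧)
  ⋀-map-∨ᶜ p (q ∷ qs) = begin
    ⟦ p ∨ᶜ q ⟧ ∧ ⋀ (map (p ∨ᶜ_) qs)  ≈⟨ ∧-cong (⟦∨ᶜ⟧ p q) (⋀-map-∨ᶜ p qs) ⟩
    (⟦ p ⟧ ∨ ⟦ q ⟧) ∧ (⟦ p ⟧ ∨ ⋀ qs)  ≈⟨ ∨-distribˡ-∧ ⟦ p ⟧ ⟦ q ⟧ (⋀ qs) ⟨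
    ⟦ p ⟧ ∨ (⟦ q ⟧ ∧ ⋀ qs)            ∎

  ⋀-∨ᶠ : ∀ ps qs → ⋀ (ps ∨ᶠ qs) ≈ ⋀ ps ∨ ⋀ qs
  ⋀-∨ᶠ []       qs = sym (∨-zeroˡ (⋀ qs))
  ⋀-∨ᶠ (p ∷ ps) qs = begin
    ⋀ (map (p ∨ᶜ_) qs ++ ps ∨ᶠ qs)          ≈⟨ ⋀-++ (map (p ∨ᶜ_) qs) (ps ∨ᶠ qs) ⟩
    ⋀ (map (p ∨ᶜ_) qs) ∧ ⋀ (ps ∨ᶠ qs)      ≈⟨ ∧-cong (⋀-map-∨ᶜ p qs) (⋀-∨ᶠ ps qs) ⟩
    (⟦ p ⟧ ∨ ⋀ qs) ∧ (⋀ ps ∨ ⋀ qs)          ≈⟨ ∨-distribʳ-∧ (⋀ qs) ⟦ p ⟧ (⋀ ps) ⟨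
    (⟦ p ⟧ ∧ ⋀ ps) ∨ ⋀ qs                   ∎

module FrontalHeytingAlgebraProperties {c ℓ₁ ℓ₂} (H : FrontalHeytingAlgebra c ℓ₁ ℓ₂) where
  open FrontalHeytingAlgebra H
  open MeetSemilatticeProperties meetSemilattice using (∧-idempotent)
  open JoinSemilatticeProperties joinSemilattice using (∨-cong)
  open HeytingAlgebraProperties heytingAlgebra using (⇨-curry; ⇨-cong)
  open ≤-Reasoning poset

  ⊠-⇨-≤ : ∀ a b → ⊠ (a ⇨ b) ≤ a ∨ (a ⇨ b)
  ⊠-⇨-≤ a b = begin
    ⊠ (a ⇨ b)            ≤⟨ ⊠-frontal (a ⇨ b) a ⟩
    a ∨ (a ⇨ (a ⇨ b))    ≈⟨ ∨-cong Eq.refl (Eq.trans (Eq.sym ⇨-curry) (⇨-cong (∧-idempotent a) Eq.refl)) ⟩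
    a ∨ (a ⇨ b)          ∎

module FreeBooleanExtension {c ℓ₁ ℓ₂ c' ℓ'}
  (H : FrontalHeytingAlgebra c ℓ₁ ℓ₂) (B : BooleanAlgebra c' ℓ')
  (e : FrontalHeytingAlgebra.Carrier H → BooleanAlgebra.Carrier B)
  (isFree : IsFreeBooleanExtension (heytingSig H) B e) where

  private
    module H = FrontalHeytingAlgebra H
  open BooleanAlgebra B
  open BooleanAlgebraProperties B using (∧-identityʳ; ∨-identityˡ; ∨-identityʳ; ¬⊤≈⊥; ¬-involutive; deMorgan₁; deMorgan₂)
  open BooleanAlgebraOrder B
  open IsFreeBooleanExtension isFree
  open FrontalHeytingAlgebraProperties H using (⊠-⇨-≤)

  e-mono : ∀ {u v} → u H.≤ v → e u ≤ e v
  e-mono {u} {v} u≤v = trans (sym (e-∧ u v)) (e-cong (H.antisym (H.x∧y≤x u v) (H.∧-greatest H.refl u≤v)))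

  e-reflects-≤ : ∀ {u v} → e u ≤ e v → u H.≤ v
  e-reflects-≤ {u} {v} eu≤ev =
    H.trans (H.reflexive (H.Eq.sym (e-injective (trans (e-∧ u v) eu≤ev)))) (H.x∧y≤y u v)

  Clause : Set c
  Clause = H.Carrier × H.Carrier

  ⟦_⟧ : Clause → Carrier
  ⟦ a , b ⟧ = ¬ e a ∨ e b

  infixr 6 _∨ᶜ_
  _∨ᶜ_ : Clause → Clause → Clause
  (a , b) ∨ᶜ (a′ , b′) = a H.∧ a′ , b H.∨ b′

  ⟦∨ᶜ⟧ : ∀ p q → ⟦ p ∨ᶜ q ⟧ ≈ ⟦ p ⟧ ∨ ⟦ q ⟧
  ⟦∨ᶜ⟧ (a , b) (a′ , b′) = begin
    ¬ e (a H.∧ a′) ∨ e (b H.∨ b′)       ≈⟨ ∨-cong (¬-cong (e-∧ a a′)) (e-∨ b b′) ⟩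
    ¬ (e a ∧ e a′) ∨ (e b ∨ e b′)       ≈⟨ ∨-cong (deMorgan₁ (e a) (e a′)) refl ⟩
    (¬ e a ∨ ¬ e a′) ∨ (e b ∨ e b′)     ≈⟨ ∨-interchange (¬ e a) (¬ e a′) (e b) (e b′) ⟩
    (¬ e a ∨ e b) ∨ (¬ e a′ ∨ e b′)     ∎
    where open ≈-Reasoning setoid

  open ClausalNormalForm B ⟦_⟧ _∨ᶜ_ ⟦∨ᶜ⟧

  ⟦⊤,_⟧ : ∀ u → ⟦ H.⊤ , u ⟧ ≈ e u
  ⟦⊤, u ⟧ = trans (∨-cong (trans (¬-cong e-⊤) ¬⊤≈⊥) refl) (∨-identityˡ (e u))

  ⟦_,⊥⟧ : ∀ u → ⟦ u , H.⊥ ⟧ ≈ ¬ e u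
  ⟦ u ,⊥⟧ = trans (∨-cong refl e-⊥) (∨-identityʳ (¬ e u))

  ⊥ᶠ : List Clause
  ⊥ᶠ = (H.⊤ , H.⊥) ∷ []

  ⋀-⊥ᶠ : ⋀ ⊥ᶠ ≈ ⊥
  ⋀-⊥ᶠ = trans (∧-identityʳ ⟦ H.⊤ , H.⊥ ⟧) (trans ⟦⊤, H.⊥ ⟧ e-⊥)

  ¬ᶜ : Clause → List Clause
  ¬ᶜ (a , b) = (H.⊤ , a) ∷ (b , H.⊥) ∷ []

  ⋀-¬ᶜ : ∀ p → ⋀ (¬ᶜ p) ≈ ¬ ⟦ p ⟧
  ⋀-¬ᶜ (a , b) = begin
    ⟦ H.⊤ , a ⟧ ∧ (⟦ b , H.⊥ ⟧ ∧ ⊤)   ≈⟨ ∧-cong ⟦⊤, a ⟧ (trans (∧-identityʳ ⟦ b , H.⊥ ⟧) ⟦ b ,⊥⟧) ⟩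
    e a ∧ ¬ e b                        ≈⟨ ∧-cong (¬-involutive (e a)) refl ⟨
    ¬ ¬ e a ∧ ¬ e b                    ≈⟨ deMorgan₂ (¬ e a) (e b) ⟨
    ¬ (¬ e a ∨ e b)                    ∎
    where open ≈-Reasoning setoid

  ¬ᶠ : List Clause → List Clause
  ¬ᶠ []       = ⊥ᶠ
  ¬ᶠ (p ∷ ps) = ¬ᶜ p ∨ᶠ ¬ᶠ ps

  ⋀-¬ᶠ : ∀ ps → ⋀ (¬ᶠ ps) ≈ ¬ ⋀ ps
  ⋀-¬ᶠ []       = trans ⋀-⊥ᶠ (sym ¬⊤≈⊥)
  ⋀-¬ᶠ (p ∷ ps) = begin
    ⋀ (¬ᶜ p ∨ᶠ ¬ᶠ ps)          ≈⟨ ⋀-∨ᶠ (¬ᶜ p) (¬ᶠ ps) ⟩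
    ⋀ (¬ᶜ p) ∨ ⋀ (¬ᶠ ps)       ≈⟨ ∨-cong (⋀-¬ᶜ p) (⋀-¬ᶠ ps) ⟩
    ¬ ⟦ p ⟧ ∨ ¬ ⋀ ps           ≈⟨ deMorgan₁ ⟦ p ⟧ (⋀ ps) ⟨
    ¬ (⟦ p ⟧ ∧ ⋀ ps)           ∎
    where open ≈-Reasoning setoid

  clauses : ∀ {x} → Generated (heytingSig H) B e x → List Clause
  clauses (gen-emb u _)   = (H.⊤ , u) ∷ []
  clauses (gen-⊤ _)       = []
  clauses (gen-⊥ _)       = ⊥ᶠ
  clauses (gen-¬ g _)     = ¬ᶠ (clauses g)
  clauses (gen-∧ g h _)   = clauses g ++ clauses h
  clauses (gen-∨ g h _)   = clauses g ∨ᶠ clauses h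

  clauses-sound : ∀ {x} (g : Generated (heytingSig H) B e x) → x ≈ ⋀ (clauses g)
  clauses-sound (gen-emb u x≈eu)  = trans x≈eu (sym (trans (∧-identityʳ ⟦ H.⊤ , u ⟧) ⟦⊤, u ⟧))
  clauses-sound (gen-⊤ x≈⊤)       = x≈⊤
  clauses-sound (gen-⊥ x≈⊥)       = trans x≈⊥ (sym ⋀-⊥ᶠ)
  clauses-sound (gen-¬ g x≈¬y)    =
    trans x≈¬y (trans (¬-cong (clauses-sound g)) (sym (⋀-¬ᶠ (clauses g))))
  clauses-sound (gen-∧ g h x≈y∧z) =
    trans x≈y∧z (trans (∧-cong (clauses-sound g) (clauses-sound h)) (sym (⋀-++ (clauses g) (clauses h))))
  clauses-sound (gen-∨ g h x≈y∨z) =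
    trans x≈y∨z (trans (∨-cong (clauses-sound g) (clauses-sound h)) (sym (⋀-∨ᶠ (clauses g) (clauses h))))

  normalForm : Carrier → List Clause
  normalForm x = clauses (generating x)

  normalForm-sound : ∀ x → x ≈ ⋀ (normalForm x)
  normalForm-sound x = clauses-sound (generating x)

  ≤-⟦⟧⇔ : ∀ {w a b} → e w ≤ ⟦ a , b ⟧ ⇔ w H.≤ a H.⇨ b
  ≤-⟦⟧⇔ {w} {a} {b} = mk⇔ to from
    where
    to : e w ≤ ⟦ a , b ⟧ → w H.≤ a H.⇨ b
    to ew≤⟦a,b⟧ = H.transpose-⇨ (e-reflects-≤ (≤-respˡ-≈ (sym (e-∧ w a)) (Equivalence.from shunt ew≤⟦a,b⟧)))
    from : w H.≤ a H.⇨ b → e w ≤ ⟦ a , b ⟧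
    from w≤a⇨b = Equivalence.to shunt (≤-respˡ-≈ (e-∧ w a) (e-mono (H.transpose-∧ w≤a⇨b)))

  ⋀⇨ : List Clause → H.Carrier
  ⋀⇨ []            = H.⊤
  ⋀⇨ ((a , b) ∷ ps) = (a H.⇨ b) H.∧ ⋀⇨ ps

  ≤-⋀⇔ : ∀ {w} ps → e w ≤ ⋀ ps ⇔ w H.≤ ⋀⇨ ps
  ≤-⋀⇔ []            = mk⇔ (λ _ → H.maximum _) (λ _ → ≤-⊤ _)
  ≤-⋀⇔ ((a , b) ∷ ps) = mk⇔
    (λ ew≤ → H.∧-greatest (Equivalence.to ≤-⟦⟧⇔ (≤-trans ew≤ (x∧y≤x _ _)))
                          (Equivalence.to (≤-⋀⇔ ps) (≤-trans ew≤ (x∧y≤y _ _))))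
    (λ w≤ → ∧-greatest (Equivalence.from ≤-⟦⟧⇔ (H.trans w≤ (H.x∧y≤x _ _)))
                       (Equivalence.from (≤-⋀⇔ ps) (H.trans w≤ (H.x∧y≤y _ _))))

  interior : Carrier → H.Carrier
  interior x = ⋀⇨ (normalForm x)

  interior-isInteriorMap : IsInteriorMap (heytingSig H) B e interior
  interior-isInteriorMap w x = mk⇔
    (λ ew≤x → Equivalence.to (≤-⋀⇔ (normalForm x)) (≤-respʳ-≈ (normalForm-sound x) ew≤x))
    (λ w≤Ix → ≤-respʳ-≈ (sym (normalForm-sound x)) (Equivalence.from (≤-⋀⇔ (normalForm x)) w≤Ix))

  module InteriorMap (I : Carrier → H.Carrier) (I-isInteriorMap : IsInteriorMap (heytingSig H) B e I) where

    I-greatest : ∀ {w x} → e w ≤ x → w H.≤ I x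
    I-greatest {w} {x} = Equivalence.to (I-isInteriorMap w x)

    e-I-≤ : ∀ x → e (I x) ≤ x
    e-I-≤ x = Equivalence.from (I-isInteriorMap (I x) x) H.refl

    I-mono : ∀ {x y} → x ≤ y → I x H.≤ I y
    I-mono x≤y = I-greatest (≤-trans (e-I-≤ _) x≤y)

    I-cong : ∀ {x y} → x ≈ y → I x H.≈ I y
    I-cong x≈y = H.antisym (I-mono (≤-reflexive x≈y)) (I-mono (≤-reflexive (sym x≈y)))

    I-e : ∀ u → I (e u) H.≈ u
    I-e u = H.antisym (e-reflects-≤ (e-I-≤ (e u))) (I-greatest ≤-refl)

    I-⊤ : I ⊤ H.≈ H.⊤
    I-⊤ = H.antisym (H.maximum _) (I-greatest (≤-⊤ _))

    I-∧ : ∀ x y → I (x ∧ y) H.≈ I x H.∧ I y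
    I-∧ x y = H.antisym
      (H.∧-greatest (I-mono (x∧y≤x x y)) (I-mono (x∧y≤y x y)))
      (I-greatest (≤-respˡ-≈ (sym (e-∧ (I x) (I y))) (∧-monotonic (e-I-≤ x) (e-I-≤ y))))

    I-⟦⟧ : ∀ a b → I ⟦ a , b ⟧ H.≈ a H.⇨ b
    I-⟦⟧ a b = H.antisym (Equivalence.to ≤-⟦⟧⇔ (e-I-≤ _)) (I-greatest (Equivalence.from ≤-⟦⟧⇔ H.refl))

    □ : Carrier → Carrier
    □ = σBox H B e I

    □-isK4 : IsK4 B □
    □-isK4 = record
      { □-cong = λ x≈y → e-cong (H.⊠-cong (I-cong x≈y))
      ; □-⊤    = trans (e-cong (H.Eq.trans (H.⊠-cong I-⊤) H.⊠-⊤)) e-⊤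
      ; □-∧    = λ x y → trans (e-cong (H.Eq.trans (H.⊠-cong (I-∧ x y)) (H.⊠-∧ (I x) (I y)))) (e-∧ _ _)
      ; □-4    = λ x → e-mono (H.trans (H.⊠-infl _) (H.reflexive (H.⊠-cong (H.Eq.sym (I-e _)))))
      }

    σ : K4Algebra c' ℓ'
    σ = record { booleanAlgebra = B ; □ = □ ; isK4 = □-isK4 }

    open IsK4 □-isK4 using (□-cong)
    open RhoLemmas σ using (IsFix; □-mono)

    e-⊠ : ∀ u → e (H.⊠ u) ≈ □ (e u)
    e-⊠ u = e-cong (H.⊠-cong (H.Eq.sym (I-e u)))

    ⟦⟧-∧-□-≤ : ∀ a b → ⟦ a , b ⟧ ∧ □ ⟦ a , b ⟧ ≤ e (a H.⇨ b)
    ⟦⟧-∧-□-≤ a b = begin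
      ⟦ a , b ⟧ ∧ □ ⟦ a , b ⟧                ≈⟨ ∧-cong refl (e-cong (H.⊠-cong (I-⟦⟧ a b))) ⟩
      ⟦ a , b ⟧ ∧ e (H.⊠ (a H.⇨ b))          ≤⟨ ∧-monotonic ≤-refl (e-mono (⊠-⇨-≤ a b)) ⟩
      ⟦ a , b ⟧ ∧ e (a H.∨ (a H.⇨ b))        ≈⟨ ∧-cong refl (e-∨ a (a H.⇨ b)) ⟩
      (¬ e a ∨ e b) ∧ (e a ∨ e (a H.⇨ b))    ≤⟨ resolution (e a) (e b) (e (a H.⇨ b)) ⟩
      e b ∨ e (a H.⇨ b)                      ≤⟨ ∨-least (e-mono y≤x⇨y) ≤-refl ⟩
      e (a H.⇨ b)                            ∎
      where
      open ≤-Reasoning poset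
      open HeytingAlgebraProperties H.heytingAlgebra using (y≤x⇨y)

    fix-≤-e-⋀⇨ : ∀ {x} → IsFix x → ∀ ps → x ≤ ⋀ ps → x ≤ e (⋀⇨ ps)
    fix-≤-e-⋀⇨ _ [] _ = ≤-respʳ-≈ (sym e-⊤) (≤-⊤ _)
    fix-≤-e-⋀⇨ {x} x≤□x ((a , b) ∷ ps) x≤⋀ = begin
      x                                        ≤⟨ ∧-greatest (∧-greatest x≤⟦a,b⟧ x≤□⟦a,b⟧) x≤e⋀⇨ps ⟩
      (⟦ a , b ⟧ ∧ □ ⟦ a , b ⟧) ∧ e (⋀⇨ ps)    ≤⟨ ∧-monotonic (⟦⟧-∧-□-≤ a b) ≤-refl ⟩
      e (a H.⇨ b) ∧ e (⋀⇨ ps)                  ≈⟨ e-∧ (a H.⇨ b) (⋀⇨ ps) ⟨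
      e ((a H.⇨ b) H.∧ ⋀⇨ ps)                  ∎
      where
      open ≤-Reasoning poset
      x≤⟦a,b⟧ : x ≤ ⟦ a , b ⟧
      x≤⟦a,b⟧ = ≤-trans x≤⋀ (x∧y≤x _ _)
      x≤□⟦a,b⟧ : x ≤ □ ⟦ a , b ⟧
      x≤□⟦a,b⟧ = ≤-trans x≤□x (□-mono x≤⟦a,b⟧)
      x≤e⋀⇨ps : x ≤ e (⋀⇨ ps)
      x≤e⋀⇨ps = fix-≤-e-⋀⇨ x≤□x ps (≤-trans x≤⋀ (x∧y≤y _ _))

    fix⇔image : ∀ x → IsFix x ⇔ (∃[ u ] x ≈ e u)
    fix⇔image x = mk⇔ to from
      where
      to : IsFix x → ∃[ u ] x ≈ e u
      to x≤□x = interior x , ≤-antisym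
        (fix-≤-e-⋀⇨ x≤□x (normalForm x) (≤-reflexive (normalForm-sound x)))
        (Equivalence.from (interior-isInteriorMap (interior x) x) H.refl)
      from : ∃[ u ] x ≈ e u → IsFix x
      from (u , x≈eu) = begin
        x             ≈⟨ x≈eu ⟩
        e u           ≤⟨ e-mono (H.⊠-infl u) ⟩
        e (H.⊠ u)     ≈⟨ e-⊠ u ⟩
        □ (e u)       ≈⟨ □-cong x≈eu ⟨
        □ x           ∎
        where open ≤-Reasoning poset

    e-⇨ : ∀ u v → e (u H.⇨ v) ≈ ⟦ u , v ⟧ ∧ □ ⟦ u , v ⟧
    e-⇨ u v = ≤-antisym
      (∧-greatest (Equivalence.from ≤-⟦⟧⇔ H.refl)
                  (≤-respʳ-≈ (e-cong (H.⊠-cong (H.Eq.sym (I-⟦⟧ u v)))) (e-mono (H.⊠-infl (u H.⇨ v)))))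
      (⟦⟧-∧-□-≤ u v)

    rhoSigmaIsId : RhoSigmaIsId H B e I
    rhoSigmaIsId = □-isK4 , fix⇔image , e-⇨ , e-⊠

module SigmaRho {m ℓm} (M : K4Algebra m ℓm) where
  open K4Algebra M
  open RhoLemmas M using (IsFix; □-mono)
  open BooleanAlgebraOrder booleanAlgebra using (≤-trans; x∧y≤x; ∧-greatest)
  open BooleanAlgebraProperties booleanAlgebra using (∧-idem)

  GeneratedByFix : Carrier → Set (m ⊔ ℓm)
  GeneratedByFix = Generated (ρSig M) booleanAlgebra proj₁

  open Subalgebra booleanAlgebra GeneratedByFix (gen-⊤ refl) (gen-⊥ refl)
    (λ g → gen-¬ g refl) (λ g h → gen-∧ g h refl) (λ g h → gen-∨ g h refl) public

  embed : BLatSig.Carrier (ρSig M) → BooleanAlgebra.Carrier subalgebra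
  embed u = proj₁ u , gen-emb u refl

  generated : ∀ {x} (g : GeneratedByFix x) → Generated (ρSig M) subalgebra embed (x , g)
  generated (gen-emb u x≈u)       = gen-emb u x≈u
  generated (gen-⊤ x≈⊤)           = gen-⊤ x≈⊤
  generated (gen-⊥ x≈⊥)           = gen-⊥ x≈⊥
  generated (gen-¬ g x≈¬y)        = gen-¬ (generated g) x≈¬y
  generated (gen-∧ g h x≈y∧z)     = gen-∧ (generated g) (generated h) x≈y∧z
  generated (gen-∨ g h x≈y∨z)     = gen-∨ (generated g) (generated h) x≈y∨z

  embed-isFreeBooleanExtension : IsFreeBooleanExtension (ρSig M) subalgebra embed
  embed-isFreeBooleanExtension = record
    { e-cong      = λ u≈v → u≈v
    ; e-injective = λ eu≈ev → eu≈ev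
    ; e-∧         = λ _ _ → refl
    ; e-∨         = λ _ _ → refl
    ; e-⊤         = refl
    ; e-⊥         = refl
    ; generating  = λ x → generated (proj₂ x)
    }

  □-□⁺ : ∀ x → □ (□⁺ x) ≈ □ x
  □-□⁺ x = trans (□-∧ x (□ x)) (□-4 x)

  fix-□⁺ : ∀ x → IsFix (□⁺ x)
  fix-□⁺ x = trans (∧-cong refl (□-□⁺ x)) (trans (∧-assoc x (□ x) (□ x)) (∧-cong refl (∧-idem (□ x))))

  interior : BooleanAlgebra.Carrier subalgebra → BLatSig.Carrier (ρSig M)
  interior (x , _) = □⁺ x , fix-□⁺ x

  interior-isInteriorMap : IsInteriorMap (ρSig M) subalgebra embed interior
  interior-isInteriorMap (u , u≤□u) (x , _) = mk⇔
    (λ u≤x → ∧-greatest u≤x (≤-trans u≤□u (□-mono u≤x)))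
    (λ u≤□⁺x → ≤-trans u≤□⁺x (x∧y≤x x (□ x)))

  proj₁-σρBox : ∀ x → proj₁ (σρBox M subalgebra embed interior x) ≈ □ (proj₁ x)
  proj₁-σρBox x = □-□⁺ (proj₁ x)

mainTheorem19 :
    ∀ {c ℓ₁ ℓ₂ c' ℓ' m ℓm} →
    -- (1) for every frontal Heyting algebra H and its free Boolean extension
    --     e : H ↪ B, the map I exists and ρ σ H = H
    ((H : FrontalHeytingAlgebra c ℓ₁ ℓ₂) (B : BooleanAlgebra c' ℓ')
     (e : FrontalHeytingAlgebra.Carrier H → BooleanAlgebra.Carrier B) →
     IsFreeBooleanExtension (heytingSig H) B e →
       Σ[ I ∈ (BooleanAlgebra.Carrier B → FrontalHeytingAlgebra.Carrier H) ]
         IsInteriorMap (heytingSig H) B e I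
       × ((I : BooleanAlgebra.Carrier B → FrontalHeytingAlgebra.Carrier H) →
          IsInteriorMap (heytingSig H) B e I →
          RhoSigmaIsId H B e I))
    ×
    -- (2) for every K4-algebra M, σ ρ M embeds into M as a modal algebra
    ((M : K4Algebra m ℓm) →
       Σ[ B ∈ BooleanAlgebra (m ⊔ ℓm) ℓm ]
       Σ[ e ∈ (BLatSig.Carrier (ρSig M) → BooleanAlgebra.Carrier B) ]
         IsFreeBooleanExtension (ρSig M) B e
       × Σ[ I ∈ (BooleanAlgebra.Carrier B → BLatSig.Carrier (ρSig M)) ]
           IsInteriorMap (ρSig M) B e I
         × Σ[ f ∈ (BooleanAlgebra.Carrier B → K4Algebra.Carrier M) ]
             IsBooleanEmbedding B (K4Algebra.booleanAlgebra M) f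
           × (∀ x → K4Algebra._≈_ M (f (σρBox M B e I x)) (K4Algebra.□ M (f x))))
mainTheorem19 =
    (λ H B e isFree → let open FreeBooleanExtension H B e isFree in
       interior , interior-isInteriorMap , InteriorMap.rhoSigmaIsId)
  , (λ M → let open SigmaRho M in
       subalgebra , embed , embed-isFreeBooleanExtension , interior , interior-isInteriorMap ,
       proj₁ , proj₁-isBooleanEmbedding , proj₁-σρBox)
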